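{- Let $\mathcal{L}$ be a conditional oriented matroid on a finite ground set $\mathcal{I}$, and let $\rho:R\to\operatorname{Rees}\operatorname{GR}(\mathcal{L})$ be the $\mathbb{Z}[u]$-algebra homomorphism sending $e_i^\pm$ to $uh_i^\pm$. Then the ideal $I_{\mathcal{L}}+J_{\mathcal{L}}$ is contained in the kernel of $\rho$.
   Context: Signed sets $X=(X^+,X^-)$ (disjoint subsets of $\mathcal{I}$), $X_i\in\{+,-,0\}$, $-X=(X^-,X^+)$, $\operatorname{Sep}(X,Y)=\{i\mid X_i=-Y_i\ne0\}$, $(X\circ Y)_i=X_i$ if $X_i\ne0$ else $Y_i$. A conditional oriented matroid is a (possibly empty) set $\mathcal{L}$ of signed sets with (FS) $X,Y\in\mathcal{L}\Rightarrow X\circ-Y\in\mathcal{L}$ and (SE) for $X,Y\in\mathcal{L}$, $i\in\operatorname{Sep}(X,Y)$ there is $Z\in\mathcal{L}$ with $Z_i=0$ and $Z_j=(X\circ Y)_j$ for $j\notin\operatorname{Sep}(X,Y)$. Circuits $\mathcal{C}$: signed sets $X$ with $X\circ Y\ne Y$ for all $Y\in\mathcal{L}$, support-minimal with this property. $\tau$: covectors nonzero in every coordinate. $\operatorname{GR}(\mathcal{L})$: functions $\tau\to\mathbb{Z}$, with Heaviside functions $h_i^+(X)=1$ if $X_i=+$, $0$ if $X_i=-$, $h_i^-=1-h_i^+$, filtered by $F_k$ = span of polynomials of degree $\le k$ in Heaviside functions; $\operatorname{Rees}\operatorname{GR}(\mathcal{L})=\bigoplus_k u^kF_k$, viewed as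 the subring of functions $\tau\to\mathbb{Z}[u]$ generated over $\mathbb{Z}[u]$ by the $uh_i^\pm$. $R=\mathbb{Z}[u,e_i^\pm]_{i\in\mathcal{I}}/\langle e_i^+e_i^-,\ e_i^++e_i^--u\rangle$; $e_X=\prod_{i\in X^+}e_i^+\prod_{i\in X^- }(-e_i^-)$; $f_X\in R$ with $uf_X=e_X-e_{ -X}$; $I_{\mathcal{L}}=\langle e_X\mid X\in\mathcal{C}\rangle$, $J_{\mathcal{L}}=\langle f_X\mid X,-X\in\mathcal{C}\rangle$. -}

module Defs where

open import Data.Nat using (ℕ; zero; suc)
open import Data.Fin using (Fin)
import Data.Fin as Fin
open import Data.Integer as ℤ using (ℤ)
open import Data.List using (List; []; _∷_)
open import Data.List.Relation.Unary.All using (All)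
open import Data.Product using (Σ; _×_)
open import Data.Sum using (_⊎_)
open import Relation.Nullary using (¬_)
open import Relation.Binary.PropositionalEquality using (_≡_; _≢_)

data Sign : Set where
  ⊕ ⊖ ∅ : Sign

SignedSet : ℕ → Set
SignedSet n = Fin n → Sign

negS : Sign → Sign
negS ⊕ = ⊖
negS ⊖ = ⊕
negS ∅ = ∅

neg : ∀ {n} → SignedSet n → SignedSet n
neg X i = negS (X i)

compS : Sign → Sign → Sign
compS ∅ t = t
compS s t = s

_∘ˢ_ : ∀ {n} → SignedSet n → SignedSet n → SignedSet n
(X ∘ˢ Y) i = compS (X i) (Y i)

Sep : ∀ {n} → SignedSet n → SignedSet n → Fin n → Set
Sep X Y i = (X i ≡ negS (Y i)) × (X i ≢ ∅)

Supp : ∀ {n} → SignedSet n → Fin n → Set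
Supp X i = X i ≢ ∅

_⊆ˢ_ : ∀ {n} → (Fin n → Set) → (Fin n → Set) → Set
A ⊆ˢ B = ∀ i → A i → B i

record IsCOM {n : ℕ} (L : SignedSet n → Set) : Set where
  field
    FS : ∀ X Y → L X → L Y → L (X ∘ˢ neg Y)
    SE : ∀ X Y → L X → L Y → ∀ i → Sep X Y i →
         Σ (SignedSet n) λ Z → L Z × (Z i ≡ ∅) ×
           (∀ j → ¬ Sep X Y j → Z j ≡ (X ∘ˢ Y) j)

NotAbsorbed : ∀ {n} → (SignedSet n → Set) → SignedSet n → Set
NotAbsorbed L X = ∀ Y → L Y → ¬ (∀ i → (X ∘ˢ Y) i ≡ Y i)

Circuit : ∀ {n} → (SignedSet n → Set) → SignedSet n → Set
Circuit L X = NotAbsorbed L X ×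
  (∀ X' → NotAbsorbed L X' → Supp X' ⊆ˢ Supp X → Supp X ⊆ˢ Supp X')

Tope : ∀ {n} → SignedSet n → Set
Tope X = ∀ i → X i ≢ ∅

-- The ring R = ℤ[u, e_i^±] / ⟨ e_i^+ e_i^- , e_i^+ + e_i^- - u ⟩ ,
-- presented as terms of the free commutative ring modulo a congruence.

data Expr (n : ℕ) : Set where
  𝟘 𝟙 u : Expr n
  e⁺ e⁻ : Fin n → Expr n
  _⊞_ _⊠_ : Expr n → Expr n → Expr n
  ⊟_ : Expr n → Expr n

infixl 6 _⊞_
infixl 7 _⊠_
infix 8 ⊟_
infix 4 _≈R_

data _≈R_ {n : ℕ} : Expr n → Expr n → Set where
  refl' : ∀ {a} → a ≈R a
  sym' : ∀ {a b} → a ≈R b → b ≈R a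
  trans' : ∀ {a b c} → a ≈R b → b ≈R c → a ≈R c
  ⊞-cong : ∀ {a b c d} → a ≈R b → c ≈R d → a ⊞ c ≈R b ⊞ d
  ⊠-cong : ∀ {a b c d} → a ≈R b → c ≈R d → a ⊠ c ≈R b ⊠ d
  ⊟-cong : ∀ {a b} → a ≈R b → ⊟ a ≈R ⊟ b
  ⊞-assoc : ∀ a b c → (a ⊞ b) ⊞ c ≈R a ⊞ (b ⊞ c)
  ⊞-comm : ∀ a b → a ⊞ b ≈R b ⊞ a
  ⊞-identity : ∀ a → 𝟘 ⊞ a ≈R a
  ⊞-inverse : ∀ a → (⊟ a) ⊞ a ≈R 𝟘
  ⊠-assoc : ∀ a b c → (a ⊠ b) ⊠ c ≈R a ⊠ (b ⊠ c)
  ⊠-comm : ∀ a b → a ⊠ b ≈R b ⊠ a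
  ⊠-identity : ∀ a → 𝟙 ⊠ a ≈R a
  distrib : ∀ a b c → a ⊠ (b ⊞ c) ≈R (a ⊠ b) ⊞ (a ⊠ c)
  rel-prod : ∀ i → e⁺ i ⊠ e⁻ i ≈R 𝟘
  rel-sum : ∀ i → e⁺ i ⊞ e⁻ i ≈R u

prodFin : ∀ {n m} → (Fin m → Expr n) → Expr n
prodFin {m = zero} f = 𝟙
prodFin {m = suc m} f = f Fin.zero ⊠ prodFin (λ i → f (Fin.suc i))

eFactor : ∀ {n} → Sign → Fin n → Expr n
eFactor ⊕ i = e⁺ i
eFactor ⊖ i = ⊟ e⁻ i
eFactor ∅ i = 𝟙

eX : ∀ {n} → SignedSet n → Expr n
eX X = prodFin (λ i → eFactor (X i) i)

data InIdeal {n : ℕ} (G : Expr n → Set) : Expr n → Set where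
  gen : ∀ {g} → G g → InIdeal G g
  zer : InIdeal G 𝟘
  add : ∀ {a b} → InIdeal G a → InIdeal G b → InIdeal G (a ⊞ b)
  mul : ∀ r {a} → InIdeal G a → InIdeal G (r ⊠ a)
  resp : ∀ {a b} → a ≈R b → InIdeal G a → InIdeal G b

-- generators of I_L + J_L :  e_X (X ∈ C)  and  f_X (X, -X ∈ C),
-- where f_X is (any representative of) the element of R with u f_X = e_X - e_{-X}
GensIJ : ∀ {n} → (SignedSet n → Set) → Expr n → Set
GensIJ {n} L g =
  (Σ (SignedSet n) λ X → Circuit L X × (g ≈R eX X)) ⊎
  (Σ (SignedSet n) λ X → Circuit L X × Circuit L (neg X) ×
     (u ⊠ g ≈R eX X ⊞ (⊟ eX (neg X))))

-- ℤ[u] as coefficient lists (constant term first)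

Poly : Set
Poly = List ℤ

_+P_ : Poly → Poly → Poly
[] +P q = q
(a ∷ p) +P [] = a ∷ p
(a ∷ p) +P (b ∷ q) = (a ℤ.+ b) ∷ (p +P q)

scaleP : ℤ → Poly → Poly
scaleP a [] = []
scaleP a (b ∷ q) = (a ℤ.* b) ∷ scaleP a q

_*P_ : Poly → Poly → Poly
[] *P q = []
(a ∷ p) *P q = scaleP a q +P (ℤ.0ℤ ∷ (p *P q))

negP : Poly → Poly
negP = scaleP (ℤ.- ℤ.1ℤ)

IsZeroP : Poly → Set
IsZeroP p = All (_≡ ℤ.0ℤ) p

uP : Poly
uP = ℤ.0ℤ ∷ ℤ.1ℤ ∷ []

constP : ℤ → Poly
constP a = a ∷ []

-- Heaviside functions and ρ : R → Rees GR(L) ⊆ (τ → ℤ[u]),  e_i^± ↦ u h_i^±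

h⁺ : ∀ {n} → SignedSet n → Fin n → ℤ
h⁺ X i with X i
... | ⊕ = ℤ.1ℤ
... | _ = ℤ.0ℤ

h⁻ : ∀ {n} → SignedSet n → Fin n → ℤ
h⁻ X i = ℤ.1ℤ ℤ.- h⁺ X i

ρ : ∀ {n} → Expr n → SignedSet n → Poly
ρ 𝟘 X = []
ρ 𝟙 X = constP ℤ.1ℤ
ρ u X = uP
ρ (e⁺ i) X = scaleP (h⁺ X i) uP
ρ (e⁻ i) X = scaleP (h⁻ X i) uP
ρ (a ⊞ b) X = ρ a X +P ρ b X
ρ (a ⊠ b) X = ρ a X *P ρ b X
ρ (⊟ a) X = negP (ρ a X)

{-# OPTIONS --safe #-}
module Submission where

-- A circuit X is not absorbed by any covector, so for a tope T ∈ L there is a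
-- coordinate i with X_i = -T_i ≠ 0; the factor of e_X at i is then sent by ρ to
-- u h_i^∓(T) = 0, whence ρ(e_X)(T) = 0. For the generators f_X of J_L this gives
-- u ρ(f_X)(T) = ρ(e_X)(T) - ρ(e_{-X})(T) = 0, and u is a non-zero-divisor of ℤ[u].
-- Finally ρ respects the defining relations of R, so its kernel at T is an ideal.

open import Defs
open import Data.Nat using (ℕ; zero; suc)
open import Data.Fin using (Fin)
import Data.Fin as Fin
open import Data.Fin.Properties using (¬∀⟶∃¬)
open import Data.Integer using (ℤ; 0ℤ; 1ℤ; _+_; _*_; -_)
import Data.Integer.Properties as ℤ
open import Data.Integer.Solver using (module +-*-Solver)
open +-*-Solver using (solve; _:+_; _:*_; _:=_; con)
open import Data.List using ([]; _∷_)
open import Data.List.Relation.Unary.All using ([]; _∷_)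
open import Data.Product using (∃; _×_; _,_)
open import Data.Sum using (inj₁; inj₂)
open import Relation.Nullary using (¬_; yes; no)
open import Relation.Binary.Definitions using (DecidableEquality)
open import Relation.Binary.PropositionalEquality
open ≡-Reasoning

_≟ˢ_ : DecidableEquality Sign
⊕ ≟ˢ ⊕ = yes refl
⊖ ≟ˢ ⊖ = yes refl
∅ ≟ˢ ∅ = yes refl
⊕ ≟ˢ ⊖ = no λ ()
⊕ ≟ˢ ∅ = no λ ()
⊖ ≟ˢ ⊕ = no λ ()
⊖ ≟ˢ ∅ = no λ ()
∅ ≟ˢ ⊕ = no λ ()
∅ ≟ˢ ⊖ = no λ ()

compS-≢⇒opposite : ∀ s t → t ≢ ∅ → compS s t ≢ t → s ≡ negS t × s ≢ ∅
compS-≢⇒opposite ⊕ ⊖ _   _     = refl , λ ()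
compS-≢⇒opposite ⊖ ⊕ _   _     = refl , λ ()
compS-≢⇒opposite ⊕ ⊕ _   st≢t  with () ← st≢t refl
compS-≢⇒opposite ⊖ ⊖ _   st≢t  with () ← st≢t refl
compS-≢⇒opposite ∅ t _   st≢t  with () ← st≢t refl
compS-≢⇒opposite ⊕ ∅ t≢∅ _     with () ← t≢∅ refl
compS-≢⇒opposite ⊖ ∅ t≢∅ _     with () ← t≢∅ refl

¬absorbs⇒separated : ∀ {n} (X T : SignedSet n) → Tope T →
                     ¬ (∀ i → (X ∘ˢ T) i ≡ T i) → ∃ (Sep X T)
¬absorbs⇒separated {n} X T T-tope ¬absorbs
  with i , XTi≢Ti ← ¬∀⟶∃¬ n (λ i → (X ∘ˢ T) i ≡ T i) (λ i → (X ∘ˢ T) i ≟ˢ T i) ¬absorbs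
  = i , compS-≢⇒opposite (X i) (T i) (T-tope i) XTi≢Ti

coeff : Poly → ℕ → ℤ
coeff []      k       = 0ℤ
coeff (a ∷ p) zero    = a
coeff (a ∷ p) (suc k) = coeff p k

infix 4 _≈P_

-- Equality in ℤ[u]: coefficient lists are compared up to trailing zeros.
_≈P_ : Poly → Poly → Set
p ≈P q = ∀ k → coeff p k ≡ coeff q k

≈P[]⇒IsZeroP : ∀ p → p ≈P [] → IsZeroP p
≈P[]⇒IsZeroP []      p≈0 = []
≈P[]⇒IsZeroP (a ∷ p) p≈0 = p≈0 zero ∷ ≈P[]⇒IsZeroP p (λ k → p≈0 (suc k))

IsZeroP⇒≈P[] : ∀ {p} → IsZeroP p → p ≈P []
IsZeroP⇒≈P[] []          k       = refl
IsZeroP⇒≈P[] (a≡0 ∷ p≡0) zero    = a≡0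
IsZeroP⇒≈P[] (a≡0 ∷ p≡0) (suc k) = IsZeroP⇒≈P[] p≡0 k

∷-cong : ∀ a {p q} → p ≈P q → a ∷ p ≈P a ∷ q
∷-cong a p≈q zero    = refl
∷-cong a p≈q (suc k) = p≈q k

coeff-+P : ∀ p q k → coeff (p +P q) k ≡ coeff p k + coeff q k
coeff-+P []      q       k       = sym (ℤ.+-identityˡ _)
coeff-+P (a ∷ p) []      k       = sym (ℤ.+-identityʳ _)
coeff-+P (a ∷ p) (b ∷ q) zero    = refl
coeff-+P (a ∷ p) (b ∷ q) (suc k) = coeff-+P p q k

coeff-scaleP : ∀ a p k → coeff (scaleP a p) k ≡ a * coeff p k
coeff-scaleP a []      k       = sym (ℤ.*-zeroʳ a)
coeff-scaleP a (b ∷ p) zero    = refl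
coeff-scaleP a (b ∷ p) (suc k) = coeff-scaleP a p k

coeff-∷*P : ∀ a p q k → coeff ((a ∷ p) *P q) k ≡ a * coeff q k + coeff (0ℤ ∷ p *P q) k
coeff-∷*P a p q k =
  trans (coeff-+P (scaleP a q) (0ℤ ∷ p *P q) k) (cong (_+ _) (coeff-scaleP a q k))

+P-cong : ∀ p p′ q q′ → p ≈P p′ → q ≈P q′ → p +P q ≈P p′ +P q′
+P-cong p p′ q q′ p≈p′ q≈q′ k = begin
  coeff (p +P q) k         ≡⟨ coeff-+P p q k ⟩
  coeff p k + coeff q k    ≡⟨ cong₂ _+_ (p≈p′ k) (q≈q′ k) ⟩
  coeff p′ k + coeff q′ k  ≡⟨ coeff-+P p′ q′ k ⟨
  coeff (p′ +P q′) k       ∎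

+P-assoc : ∀ p q r → (p +P q) +P r ≈P p +P (q +P r)
+P-assoc p q r k = begin
  coeff ((p +P q) +P r) k                ≡⟨ coeff-+P (p +P q) r k ⟩
  coeff (p +P q) k + coeff r k           ≡⟨ cong (_+ coeff r k) (coeff-+P p q k) ⟩
  coeff p k + coeff q k + coeff r k      ≡⟨ ℤ.+-assoc (coeff p k) (coeff q k) (coeff r k) ⟩
  coeff p k + (coeff q k + coeff r k)    ≡⟨ cong (coeff p k +_) (coeff-+P q r k) ⟨
  coeff p k + coeff (q +P r) k           ≡⟨ coeff-+P p (q +P r) k ⟨
  coeff (p +P (q +P r)) k                ∎

+P-comm : ∀ p q → p +P q ≈P q +P p
+P-comm p q k = begin
  coeff (p +P q) k       ≡⟨ coeff-+P p q k ⟩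
  coeff p k + coeff q k  ≡⟨ ℤ.+-comm (coeff p k) (coeff q k) ⟩
  coeff q k + coeff p k  ≡⟨ coeff-+P q p k ⟨
  coeff (q +P p) k       ∎

negP-cong : ∀ p q → p ≈P q → negP p ≈P negP q
negP-cong p q p≈q k = begin
  coeff (negP p) k      ≡⟨ coeff-scaleP (- 1ℤ) p k ⟩
  - 1ℤ * coeff p k      ≡⟨ cong (- 1ℤ *_) (p≈q k) ⟩
  - 1ℤ * coeff q k      ≡⟨ coeff-scaleP (- 1ℤ) q k ⟨
  coeff (negP q) k      ∎

negP-inverseˡ : ∀ p → negP p +P p ≈P []
negP-inverseˡ p k = begin
  coeff (negP p +P p) k              ≡⟨ coeff-+P (negP p) p k ⟩
  coeff (negP p) k + coeff p k       ≡⟨ cong (_+ coeff p k) (coeff-scaleP (- 1ℤ) p k) ⟩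
  - 1ℤ * coeff p k + coeff p k       ≡⟨ solve 1 (λ x → con (- 1ℤ) :* x :+ x := con 0ℤ) refl (coeff p k) ⟩
  0ℤ                                 ∎

∷-zero : ∀ {p} → p ≈P [] → 0ℤ ∷ p ≈P []
∷-zero p≈0 zero    = refl
∷-zero p≈0 (suc k) = p≈0 k

*P-zeroˡ : ∀ p q → p ≈P [] → p *P q ≈P []
*P-zeroˡ []      q p≈0 k = refl
*P-zeroˡ (a ∷ p) q p≈0 k = trans (coeff-∷*P a p q k)
  (cong₂ _+_ (cong (_* coeff q k) (p≈0 zero)) (∷-zero (*P-zeroˡ p q (λ i → p≈0 (suc i))) k))

*P-zeroʳ : ∀ p → p *P [] ≈P []
*P-zeroʳ []      k = refl
*P-zeroʳ (a ∷ p) k = trans (coeff-∷*P a p [] k)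
  (cong₂ _+_ (ℤ.*-zeroʳ a) (∷-zero (*P-zeroʳ p) k))

*P-congʳ : ∀ p p′ q → p ≈P p′ → p *P q ≈P p′ *P q
*P-congʳ []      []       q p≈p′ k = refl
*P-congʳ []      (b ∷ p′) q p≈p′ k = sym (*P-zeroˡ (b ∷ p′) q (λ i → sym (p≈p′ i)) k)
*P-congʳ (a ∷ p) []       q p≈p′ k = *P-zeroˡ (a ∷ p) q p≈p′ k
*P-congʳ (a ∷ p) (b ∷ p′) q p≈p′ k = begin
  coeff ((a ∷ p) *P q) k                       ≡⟨ coeff-∷*P a p q k ⟩
  a * coeff q k + coeff (0ℤ ∷ p *P q) k        ≡⟨ cong₂ _+_ (cong (_* coeff q k) (p≈p′ zero))
                                                   (∷-cong 0ℤ (*P-congʳ p p′ q (λ i → p≈p′ (suc i))) k) ⟩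
  b * coeff q k + coeff (0ℤ ∷ p′ *P q) k       ≡⟨ coeff-∷*P b p′ q k ⟨
  coeff ((b ∷ p′) *P q) k                      ∎

*P-∷ʳ : ∀ p a q k → coeff (p *P (a ∷ q)) k ≡ a * coeff p k + coeff (0ℤ ∷ p *P q) k
*P-∷ʳ []      a q zero    rewrite ℤ.*-zeroʳ a = refl
*P-∷ʳ []      a q (suc k) rewrite ℤ.*-zeroʳ a = refl
*P-∷ʳ (b ∷ p) a q zero    = trans (coeff-∷*P b p (a ∷ q) zero)
  (cong (_+ 0ℤ) (ℤ.*-comm b a))
*P-∷ʳ (b ∷ p) a q (suc k) = begin
  coeff ((b ∷ p) *P (a ∷ q)) (suc k)                   ≡⟨ coeff-∷*P b p (a ∷ q) (suc k) ⟩
  b * coeff q k + coeff (p *P (a ∷ q)) k               ≡⟨ cong (b * coeff q k +_) (*P-∷ʳ p a q k) ⟩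
  b * coeff q k + (a * coeff p k + coeff (0ℤ ∷ p *P q) k)
    ≡⟨ solve 5 (λ a b x y z → b :* x :+ (a :* y :+ z) := a :* y :+ (b :* x :+ z))
         refl a b (coeff q k) (coeff p k) (coeff (0ℤ ∷ p *P q) k) ⟩
  a * coeff p k + (b * coeff q k + coeff (0ℤ ∷ p *P q) k)
    ≡⟨ cong (a * coeff p k +_) (coeff-∷*P b p q k) ⟨
  a * coeff p k + coeff ((b ∷ p) *P q) k               ∎

*P-comm : ∀ p q → p *P q ≈P q *P p
*P-comm []      q k = sym (*P-zeroʳ q k)
*P-comm (a ∷ p) q k = begin
  coeff ((a ∷ p) *P q) k                  ≡⟨ coeff-∷*P a p q k ⟩
  a * coeff q k + coeff (0ℤ ∷ p *P q) k   ≡⟨ cong (a * coeff q k +_) (∷-cong 0ℤ (*P-comm p q) k) ⟩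
  a * coeff q k + coeff (0ℤ ∷ q *P p) k   ≡⟨ *P-∷ʳ q a p k ⟨
  coeff (q *P (a ∷ p)) k                  ∎

*P-cong : ∀ p p′ q q′ → p ≈P p′ → q ≈P q′ → p *P q ≈P p′ *P q′
*P-cong p p′ q q′ p≈p′ q≈q′ k = begin
  coeff (p *P q) k    ≡⟨ *P-congʳ p p′ q p≈p′ k ⟩
  coeff (p′ *P q) k   ≡⟨ *P-comm p′ q k ⟩
  coeff (q *P p′) k   ≡⟨ *P-congʳ q q′ p′ q≈q′ k ⟩
  coeff (q′ *P p′) k  ≡⟨ *P-comm q′ p′ k ⟩
  coeff (p′ *P q′) k  ∎

*P-distribʳ : ∀ p q r → (p +P q) *P r ≈P (p *P r) +P (q *P r)
*P-distribʳ []      q       r k = refl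
*P-distribʳ (a ∷ p) []      r k = sym (trans (coeff-+P ((a ∷ p) *P r) [] k) (ℤ.+-identityʳ _))
*P-distribʳ (a ∷ p) (b ∷ q) r k = begin
  coeff (((a + b) ∷ (p +P q)) *P r) k
    ≡⟨ coeff-∷*P (a + b) (p +P q) r k ⟩
  (a + b) * coeff r k + coeff (0ℤ ∷ (p +P q) *P r) k
    ≡⟨ cong ((a + b) * coeff r k +_) (tail-distrib k) ⟩
  (a + b) * coeff r k + (coeff (0ℤ ∷ p *P r) k + coeff (0ℤ ∷ q *P r) k)
    ≡⟨ solve 5 (λ a b c x y → (a :+ b) :* c :+ (x :+ y) := (a :* c :+ x) :+ (b :* c :+ y))
         refl a b (coeff r k) (coeff (0ℤ ∷ p *P r) k) (coeff (0ℤ ∷ q *P r) k) ⟩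
  (a * coeff r k + coeff (0ℤ ∷ p *P r) k) + (b * coeff r k + coeff (0ℤ ∷ q *P r) k)
    ≡⟨ cong₂ _+_ (coeff-∷*P a p r k) (coeff-∷*P b q r k) ⟨
  coeff ((a ∷ p) *P r) k + coeff ((b ∷ q) *P r) k
    ≡⟨ coeff-+P ((a ∷ p) *P r) ((b ∷ q) *P r) k ⟨
  coeff (((a ∷ p) *P r) +P ((b ∷ q) *P r)) k ∎
  where
  tail-distrib : ∀ k → coeff (0ℤ ∷ (p +P q) *P r) k ≡ coeff (0ℤ ∷ p *P r) k + coeff (0ℤ ∷ q *P r) k
  tail-distrib zero    = refl
  tail-distrib (suc j) = trans (*P-distribʳ p q r j) (coeff-+P (p *P r) (q *P r) j)

*P-scaleˡ : ∀ a p q → scaleP a p *P q ≈P scaleP a (p *P q)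
*P-scaleˡ a []      q k = refl
*P-scaleˡ a (b ∷ p) q k = begin
  coeff ((a * b ∷ scaleP a p) *P q) k
    ≡⟨ coeff-∷*P (a * b) (scaleP a p) q k ⟩
  a * b * coeff q k + coeff (0ℤ ∷ scaleP a p *P q) k
    ≡⟨ cong (a * b * coeff q k +_) (tail-scale k) ⟩
  a * b * coeff q k + a * coeff (0ℤ ∷ p *P q) k
    ≡⟨ solve 4 (λ a b c x → a :* b :* c :+ a :* x := a :* (b :* c :+ x))
         refl a b (coeff q k) (coeff (0ℤ ∷ p *P q) k) ⟩
  a * (b * coeff q k + coeff (0ℤ ∷ p *P q) k)
    ≡⟨ cong (a *_) (coeff-∷*P b p q k) ⟨
  a * coeff ((b ∷ p) *P q) k
    ≡⟨ coeff-scaleP a ((b ∷ p) *P q) k ⟨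
  coeff (scaleP a ((b ∷ p) *P q)) k ∎
  where
  tail-scale : ∀ k → coeff (0ℤ ∷ scaleP a p *P q) k ≡ a * coeff (0ℤ ∷ p *P q) k
  tail-scale zero    = sym (ℤ.*-zeroʳ a)
  tail-scale (suc j) = trans (*P-scaleˡ a p q j) (coeff-scaleP a (p *P q) j)

*P-assoc : ∀ p q r → (p *P q) *P r ≈P p *P (q *P r)
*P-assoc []      q r k = refl
*P-assoc (a ∷ p) q r k = begin
  coeff ((scaleP a q +P (0ℤ ∷ p *P q)) *P r) k
    ≡⟨ *P-distribʳ (scaleP a q) (0ℤ ∷ p *P q) r k ⟩
  coeff ((scaleP a q *P r) +P ((0ℤ ∷ p *P q) *P r)) k
    ≡⟨ coeff-+P (scaleP a q *P r) ((0ℤ ∷ p *P q) *P r) k ⟩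
  coeff (scaleP a q *P r) k + coeff ((0ℤ ∷ p *P q) *P r) k
    ≡⟨ cong₂ _+_ (trans (*P-scaleˡ a q r k) (coeff-scaleP a (q *P r) k)) (tail-assoc k) ⟩
  a * coeff (q *P r) k + coeff (0ℤ ∷ p *P (q *P r)) k
    ≡⟨ coeff-∷*P a p (q *P r) k ⟨
  coeff ((a ∷ p) *P (q *P r)) k ∎
  where
  tail-assoc : ∀ k → coeff ((0ℤ ∷ p *P q) *P r) k ≡ coeff (0ℤ ∷ p *P (q *P r)) k
  tail-assoc k = begin
    coeff ((0ℤ ∷ p *P q) *P r) k                  ≡⟨ coeff-∷*P 0ℤ (p *P q) r k ⟩
    0ℤ * coeff r k + coeff (0ℤ ∷ (p *P q) *P r) k ≡⟨ ℤ.+-identityˡ _ ⟩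
    coeff (0ℤ ∷ (p *P q) *P r) k                  ≡⟨ ∷-cong 0ℤ (*P-assoc p q r) k ⟩
    coeff (0ℤ ∷ p *P (q *P r)) k                  ∎

*P-identityˡ : ∀ p → constP 1ℤ *P p ≈P p
*P-identityˡ p k = begin
  coeff (constP 1ℤ *P p) k           ≡⟨ coeff-∷*P 1ℤ [] p k ⟩
  1ℤ * coeff p k + coeff (0ℤ ∷ []) k ≡⟨ cong (1ℤ * coeff p k +_) (IsZeroP⇒≈P[] (refl ∷ []) k) ⟩
  1ℤ * coeff p k + 0ℤ                ≡⟨ ℤ.+-identityʳ _ ⟩
  1ℤ * coeff p k                     ≡⟨ ℤ.*-identityˡ _ ⟩
  coeff p k                          ∎

uP*P-cancel : ∀ p → uP *P p ≈P [] → p ≈P []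
uP*P-cancel p up≈0 k = begin
  coeff p k                                      ≡⟨ *P-identityˡ p k ⟨
  coeff (constP 1ℤ *P p) k                       ≡⟨ ℤ.+-identityˡ _ ⟨
  0ℤ * coeff p (suc k) + coeff (constP 1ℤ *P p) k ≡⟨ coeff-∷*P 0ℤ (constP 1ℤ) p (suc k) ⟨
  coeff (uP *P p) (suc k)                        ≡⟨ up≈0 (suc k) ⟩
  0ℤ                                             ∎

module _ {n : ℕ} (T : SignedSet n) where

  ρ-rel-prod : ∀ i → ρ (e⁺ i ⊠ e⁻ i) T ≈P []
  ρ-rel-prod i with T i
  ... | ⊕ = IsZeroP⇒≈P[] (refl ∷ refl ∷ refl ∷ [])
  ... | ⊖ = IsZeroP⇒≈P[] (refl ∷ refl ∷ refl ∷ [])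
  ... | ∅ = IsZeroP⇒≈P[] (refl ∷ refl ∷ refl ∷ [])

  ρ-rel-sum : ∀ i → ρ (e⁺ i ⊞ e⁻ i) T ≡ uP
  ρ-rel-sum i with T i
  ... | ⊕ = refl
  ... | ⊖ = refl
  ... | ∅ = refl

  ρ-resp-≈R : ∀ {a b : Expr n} → a ≈R b → ρ a T ≈P ρ b T
  ρ-resp-≈R refl'               k = refl
  ρ-resp-≈R (sym' a≈b)          k = sym (ρ-resp-≈R a≈b k)
  ρ-resp-≈R (trans' a≈b b≈c)    k = trans (ρ-resp-≈R a≈b k) (ρ-resp-≈R b≈c k)
  ρ-resp-≈R (⊞-cong {a} {b} {c} {d} a≈b c≈d) =
    +P-cong (ρ a T) (ρ b T) (ρ c T) (ρ d T) (ρ-resp-≈R a≈b) (ρ-resp-≈R c≈d)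
  ρ-resp-≈R (⊠-cong {a} {b} {c} {d} a≈b c≈d) =
    *P-cong (ρ a T) (ρ b T) (ρ c T) (ρ d T) (ρ-resp-≈R a≈b) (ρ-resp-≈R c≈d)
  ρ-resp-≈R (⊟-cong {a} {b} a≈b)  = negP-cong (ρ a T) (ρ b T) (ρ-resp-≈R a≈b)
  ρ-resp-≈R (⊞-assoc a b c)       = +P-assoc (ρ a T) (ρ b T) (ρ c T)
  ρ-resp-≈R (⊞-comm a b)          = +P-comm (ρ a T) (ρ b T)
  ρ-resp-≈R (⊞-identity a)      k = refl
  ρ-resp-≈R (⊞-inverse a)         = negP-inverseˡ (ρ a T)
  ρ-resp-≈R (⊠-assoc a b c)       = *P-assoc (ρ a T) (ρ b T) (ρ c T)
  ρ-resp-≈R (⊠-comm a b)          = *P-comm (ρ a T) (ρ b T)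
  ρ-resp-≈R (⊠-identity a)        = *P-identityˡ (ρ a T)
  ρ-resp-≈R (distrib a b c)     k = begin
    coeff (ρ a T *P (ρ b T +P ρ c T)) k           ≡⟨ *P-comm (ρ a T) (ρ b T +P ρ c T) k ⟩
    coeff ((ρ b T +P ρ c T) *P ρ a T) k           ≡⟨ *P-distribʳ (ρ b T) (ρ c T) (ρ a T) k ⟩
    coeff ((ρ b T *P ρ a T) +P (ρ c T *P ρ a T)) k
      ≡⟨ +P-cong (ρ b T *P ρ a T) (ρ a T *P ρ b T) (ρ c T *P ρ a T) (ρ a T *P ρ c T)
                 (*P-comm (ρ b T) (ρ a T)) (*P-comm (ρ c T) (ρ a T)) k ⟩
    coeff ((ρ a T *P ρ b T) +P (ρ a T *P ρ c T)) k ∎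
  ρ-resp-≈R (rel-prod i)          = ρ-rel-prod i
  ρ-resp-≈R (rel-sum i)         k = cong (λ p → coeff p k) (ρ-rel-sum i)

  ρ-vanishes-on-ideal : ∀ {G : Expr n → Set} → (∀ {g} → G g → ρ g T ≈P []) →
                        ∀ {x} → InIdeal G x → ρ x T ≈P []
  ρ-vanishes-on-ideal onG (gen g∈G)         = onG g∈G
  ρ-vanishes-on-ideal onG zer             k = refl
  ρ-vanishes-on-ideal onG (add {a} {b} a∈I b∈I) k =
    trans (coeff-+P (ρ a T) (ρ b T) k)
          (cong₂ _+_ (ρ-vanishes-on-ideal onG a∈I k) (ρ-vanishes-on-ideal onG b∈I k))
  ρ-vanishes-on-ideal onG (mul r {a} a∈I) k =
    trans (*P-comm (ρ r T) (ρ a T) k) (*P-zeroˡ (ρ a T) (ρ r T) (ρ-vanishes-on-ideal onG a∈I) k)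
  ρ-vanishes-on-ideal onG (resp a≈b a∈I)  k =
    trans (sym (ρ-resp-≈R a≈b k)) (ρ-vanishes-on-ideal onG a∈I k)

  ρ-prodFin-zero : ∀ {m} (f : Fin m → Expr n) i → ρ (f i) T ≈P [] → ρ (prodFin f) T ≈P []
  ρ-prodFin-zero f Fin.zero    fi≈0   = *P-zeroˡ (ρ (f Fin.zero) T) _ fi≈0
  ρ-prodFin-zero {suc m} f (Fin.suc i) fi≈0 k =
    trans (*P-comm (ρ (f Fin.zero) T) (ρ (prodFin f′) T) k)
          (*P-zeroˡ (ρ (prodFin f′) T) (ρ (f Fin.zero) T) (ρ-prodFin-zero f′ i fi≈0) k)
    where
    f′ : Fin m → Expr n
    f′ j = f (Fin.suc j)

  ρ-eFactor-opposite : ∀ i s → s ≡ negS (T i) → s ≢ ∅ → ρ (eFactor s i) T ≈P []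
  ρ-eFactor-opposite i ⊕ _ _ with T i
  ... | ⊖ = IsZeroP⇒≈P[] (refl ∷ refl ∷ [])
  ρ-eFactor-opposite i ⊖ _ _ with T i
  ... | ⊕ = IsZeroP⇒≈P[] (refl ∷ refl ∷ [])
  ρ-eFactor-opposite i ∅ _ ∅≢∅ with () ← ∅≢∅ refl

  ρ-eX-separated : ∀ X i → Sep X T i → ρ (eX X) T ≈P []
  ρ-eX-separated X i (Xi≡-Ti , Xi≢∅) =
    ρ-prodFin-zero (λ j → eFactor (X j) j) i (ρ-eFactor-opposite i (X i) Xi≡-Ti Xi≢∅)

lemma5p1 : ∀ {n : ℕ} (L : SignedSet n → Set) → IsCOM L →
           ∀ (x : Expr n) → InIdeal (GensIJ L) x →
           ∀ (T : SignedSet n) → L T → Tope T → IsZeroP (ρ x T)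
lemma5p1 L _ x x∈I T T∈L T-tope =
  ≈P[]⇒IsZeroP (ρ x T) (ρ-vanishes-on-ideal T generator-vanishes x∈I)
  where
  circuit-vanishes : ∀ {X} → NotAbsorbed L X → ρ (eX X) T ≈P []
  circuit-vanishes {X} X-free with i , i∈Sep ← ¬absorbs⇒separated X T T-tope (X-free T T∈L) =
    ρ-eX-separated T X i i∈Sep

  generator-vanishes : ∀ {g} → GensIJ L g → ρ g T ≈P []
  generator-vanishes (inj₁ (X , (X-free , _) , g≈eX)) k =
    trans (ρ-resp-≈R T g≈eX k) (circuit-vanishes X-free k)
  generator-vanishes {g} (inj₂ (X , (X-free , _) , (-X-free , _) , ug≈eX-e-X)) =
    uP*P-cancel (ρ g T) λ k → trans (ρ-resp-≈R T ug≈eX-e-X k)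
      (+P-cong (ρ (eX X) T) [] (negP (ρ (eX (neg X)) T)) []
        (circuit-vanishes X-free) (negP-cong (ρ (eX (neg X)) T) [] (circuit-vanishes -X-free)) k)
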